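{- Let $G$ be a graph without isolated vertices. Then $min_D(G)\leq \dfrac{|V(G)|}{2}$.
   Context: All graphs are finite and simple. In the irreversible majority conversion process on a graph $G$, every vertex is black or white at each discrete time step $t=0,1,2,\ldots$. A black vertex stays black forever. A white vertex $v$ of degree $\deg_G(v)\geq 1$ becomes black at time $t$ if at least $\deg_G(v)/2$ of its neighbors are black at time $t-1$. An isolated vertex never changes color. A dynamo of $G$ is a set $D\subseteq V(G)$ such that, if exactly the vertices of $D$ are black at time $0$, then every vertex of $G$ is eventually black. $min_D(G)$ denotes the minimum size of a dynamo of $G$. -}

module Defs where

open import Data.Nat using (ℕ; zero; suc; _+_; _*_; _≤_; _≥_)
open import Data.Bool using (Bool; true; false; _∨_; _∧_; if_then_else_)
open import Data.Fin using (Fin)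
open import Data.Vec using (Vec; tabulate; lookup; count; allFin)
open import Data.Fin.Subset using (Subset; ∣_∣; ⊤)
open import Data.Product using (Σ; ∃; _×_)
open import Relation.Binary.PropositionalEquality using (_≡_)
open import Relation.Nullary using (¬_)
open import Relation.Nullary.Decidable using (⌊_⌋)
open import Data.Nat using (_≤?_)
open import Function using (_∘_)

record Graph (n : ℕ) : Set where
  field
    adj   : Fin n → Fin n → Bool
    sym   : ∀ u v → adj u v ≡ adj v u
    irrefl : ∀ v → adj v v ≡ false
open Graph public

deg : ∀ {n} → Graph n → Fin n → ℕ
deg G v = count (λ u → adj G v u ≡? true) (allFin _)
  where
  open import Data.Bool.Properties using () renaming (_≟_ to _≡?_)

blackNbrs : ∀ {n} → Graph n → Subset n → Fin n → ℕ
blackNbrs G S v = count (λ u → (adj G v u ∧ lookup S u) ≡? true) (allFin _)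
  where
  open import Data.Bool.Properties using () renaming (_≟_ to _≡?_)

fires : ∀ {n} → Graph n → Subset n → Fin n → Bool
fires G S v = ⌊ 1 ≤? deg G v ⌋ ∧ ⌊ deg G v ≤? 2 * blackNbrs G S v ⌋

step : ∀ {n} → Graph n → Subset n → Subset n
step G S = tabulate (λ v → lookup S v ∨ fires G S v)

stateAt : ∀ {n} → Graph n → Subset n → ℕ → Subset n
stateAt G D zero    = D
stateAt G D (suc t) = step G (stateAt G D t)

IsDynamo : ∀ {n} → Graph n → Subset n → Set
IsDynamo G D = ∃ λ t → stateAt G D t ≡ ⊤

NoIsolated : ∀ {n} → Graph n → Set
NoIsolated G = ∀ v → 1 ≤ deg G v

-- Take a 2-colouring of the vertices in which no single recolouring reduces the
-- number of monochromatic edges.  Recolouring v swaps its monochromatic and its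
-- bichromatic edges, so such a colouring is reached by repeatedly recolouring a
-- vertex with more neighbours of its own colour than of the other.  In this
-- unfriendly partition every vertex has at least half of its neighbours in the
-- other class, so, with no isolated vertices, either colour class blackens all
-- remaining vertices in one step; the smaller class has at most |V(G)|/2 vertices.
module Submission where

open import Defs hiding (sym)
open import Data.Nat.Properties
  using (+-0-commutativeMonoid; _≤?_; +-identityʳ; +-comm; +-assoc; +-cancelʳ-<; +-monoʳ-<; +-mono-<;
         +-monoˡ-≤; *-distribˡ-∸; m≤n+o⇒m∸n≤o; <⇒≤; ≰⇒>; module ≤-Reasoning)
open import Algebra.Properties.CommutativeMonoid.Sum +-0-commutativeMonoid
  using (sum-syntax; ∑-distrib-+; ∑-comm; sum-cong-≗; sum-replicate-zero)
open import Data.Bool.Base using (Bool; true; false; not; _∧_; _∨_; _xor_; if_then_else_)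
open import Data.Bool.Properties using (xor-comm; not-involutive) renaming (_≟_ to _≟ᵇ_)
open import Data.Fin.Base using (Fin; zero; suc)
open import Data.Fin.Properties using (_≟_; all?; ¬∀⟶∃¬)
open import Data.Fin.Subset using (Subset; ∣_∣; ∁; ⊤)
open import Data.Fin.Subset.Properties using (∣∁p∣≡n∸∣p∣)
open import Data.Nat.Base using (ℕ; zero; suc; _+_; _*_; _∸_; _≤_; _<_)
open import Data.Nat.Induction using (<-wellFounded)
open import Data.Product.Base using (Σ; _×_; _,_)
open import Data.Sum.Base using (_⊎_; inj₁; inj₂)
open import Data.Vec.Base using (tabulate; lookup; count)
open import Data.Vec.Properties
  using (lookup∘tabulate; tabulate∘lookup; tabulate-cong; tabulate-∘; lookup-replicate)
open import Data.Vec.Functional using (updateAt)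
open import Data.Vec.Functional.Properties using (updateAt-updates; updateAt-minimal)
open import Function.Base using (_∘_)
open import Induction.WellFounded using (Acc; acc)
open import Relation.Binary.PropositionalEquality
open import Relation.Nullary using (Dec; yes; no; does; ¬_)
open import Relation.Nullary.Decidable using (⌊_⌋; isYes≗does; dec-true)

toℕ : Bool → ℕ
toℕ true  = 1
toℕ false = 0

toℕ-∧-split : ∀ a b → toℕ a ≡ toℕ (a ∧ not b) + toℕ (a ∧ b)
toℕ-∧-split true  true  = refl
toℕ-∧-split true  false = refl
toℕ-∧-split false b     = refl

count-tabulate : ∀ {n} {A : Set} (p : A → Bool) (g : Fin n → A) →
  count (λ x → p x ≟ᵇ true) (tabulate g) ≡ ∑[ i < n ] toℕ (p (g i))
count-tabulate {zero}  p g = refl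
count-tabulate {suc n} p g with p (g zero)
... | true  = cong suc (count-tabulate p (g ∘ suc))
... | false = count-tabulate p (g ∘ suc)

only : ∀ {n} → Fin n → Fin n → ℕ → ℕ
only v u x = if does (u ≟ v) then x else 0

sum-only : ∀ {n} (v : Fin n) (f : Fin n → ℕ) → ∑[ u < n ] only v u (f u) ≡ f v
sum-only {suc n} zero    f = trans (cong (f zero +_) (sum-replicate-zero n)) (+-identityʳ (f zero))
sum-only {suc n} (suc v) f = sum-only v (f ∘ suc)

∑₂-distrib-+ : ∀ {n} (f g : Fin n → Fin n → ℕ) →
  ∑[ u < n ] ∑[ w < n ] (f u w + g u w) ≡ ∑[ u < n ] ∑[ w < n ] f u w + ∑[ u < n ] ∑[ w < n ] g u w
∑₂-distrib-+ {n} f g = trans (sum-cong-≗ (λ u → ∑-distrib-+ (f u) (g u)))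
                              (∑-distrib-+ (λ u → ∑[ w < n ] f u w) (λ u → ∑[ w < n ] g u w))

∑₂-only : ∀ {n} (v : Fin n) (f g : Fin n → Fin n → ℕ) →
  ∑[ u < n ] ∑[ w < n ] (f u w + only v u (g u w) + only v w (g u w))
    ≡ ∑[ u < n ] ∑[ w < n ] f u w + ∑[ w < n ] g v w + ∑[ u < n ] g u v
∑₂-only {n} v f g = begin
  ∑[ u < n ] ∑[ w < n ] (f u w + only v u (g u w) + only v w (g u w))
    ≡⟨ ∑₂-distrib-+ (λ u w → f u w + only v u (g u w)) (λ u w → only v w (g u w)) ⟩
  ∑[ u < n ] ∑[ w < n ] (f u w + only v u (g u w)) + ∑[ u < n ] ∑[ w < n ] only v w (g u w)
    ≡⟨ cong₂ _+_ (∑₂-distrib-+ f (λ u w → only v u (g u w))) (sum-cong-≗ (λ u → sum-only v (g u))) ⟩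
  ∑[ u < n ] ∑[ w < n ] f u w + ∑[ u < n ] ∑[ w < n ] only v u (g u w) + ∑[ u < n ] g u v
    ≡⟨ cong (λ x → ∑[ u < n ] ∑[ w < n ] f u w + x + ∑[ u < n ] g u v) rows ⟩
  ∑[ u < n ] ∑[ w < n ] f u w + ∑[ w < n ] g v w + ∑[ u < n ] g u v ∎
  where
  open ≡-Reasoning
  rows : ∑[ u < n ] ∑[ w < n ] only v u (g u w) ≡ ∑[ w < n ] g v w
  rows = trans (∑-comm (λ u w → only v u (g u w))) (sum-cong-≗ (λ w → sum-only v (λ u → g u w)))

m+o+o≡n+p+p∧o<p⇒n<m : ∀ {m n o p} → m + o + o ≡ n + p + p → o < p → n < m
m+o+o≡n+p+p∧o<p⇒n<m {m} {n} {o} {p} eq o<p = +-cancelʳ-< (p + p) n m (begin-strict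
  n + (p + p)  ≡⟨ +-assoc n p p ⟨
  n + p + p    ≡⟨ eq ⟨
  m + o + o    ≡⟨ +-assoc m o o ⟩
  m + (o + o)  <⟨ +-monoʳ-< m (+-mono-< o<p o<p) ⟩
  m + (p + p)  ∎)
  where open ≤-Reasoning

n≤2m⇒2[n∸m]≤n : ∀ {m n} → n ≤ 2 * m → 2 * (n ∸ m) ≤ n
n≤2m⇒2[n∸m]≤n {m} {n} n≤2m = begin
  2 * (n ∸ m)    ≡⟨ *-distribˡ-∸ 2 n m ⟩
  2 * n ∸ 2 * m  ≤⟨ m≤n+o⇒m∸n≤o (2 * n) (2 * m) (begin
    2 * n          ≡⟨ cong (n +_) (+-identityʳ n) ⟩
    n + n          ≤⟨ +-monoˡ-≤ n n≤2m ⟩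
    2 * m + n      ∎) ⟩
  n              ∎
  where open ≤-Reasoning

smaller-half : ∀ {n} (p : Subset n) → 2 * ∣ p ∣ ≤ n ⊎ 2 * ∣ ∁ p ∣ ≤ n
smaller-half {n} p with 2 * ∣ p ∣ ≤? n
... | yes small = inj₁ small
... | no large  = inj₂ (subst (λ k → 2 * k ≤ n) (sym (∣∁p∣≡n∸∣p∣ p))
                             (n≤2m⇒2[n∸m]≤n {∣ p ∣} (<⇒≤ (≰⇒> large))))

not-xor-not : ∀ a b → not a xor not b ≡ a xor b
not-xor-not true  b = refl
not-xor-not false b = not-involutive b

not-xor : ∀ a b → not (not a xor b) ≡ a xor b
not-xor true  b = refl
not-xor false b = not-involutive b

recolour : ∀ {n} → Fin n → (Fin n → Bool) → Fin n → Bool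
recolour v c = updateAt c v not

module _ {n : ℕ} (G : Graph n) where

  monochromatic bichromatic : (Fin n → Bool) → Fin n → Fin n → ℕ
  monochromatic c u w = toℕ (adj G u w ∧ not (c u xor c w))
  bichromatic   c u w = toℕ (adj G u w ∧ (c u xor c w))

  sameDeg crossDeg : (Fin n → Bool) → Fin n → ℕ
  sameDeg  c v = ∑[ w < n ] monochromatic c v w
  crossDeg c v = ∑[ w < n ] bichromatic c v w

  monoEdges : (Fin n → Bool) → ℕ
  monoEdges c = ∑[ u < n ] sameDeg c u

  Unfriendly : (Fin n → Bool) → Set
  Unfriendly c = ∀ v → deg G v ≤ 2 * crossDeg c v

  deg-split : ∀ c v → deg G v ≡ sameDeg c v + crossDeg c v
  deg-split c v = begin
    deg G v
      ≡⟨ count-tabulate (adj G v) (λ w → w) ⟩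
    ∑[ w < n ] toℕ (adj G v w)
      ≡⟨ sum-cong-≗ (λ w → toℕ-∧-split (adj G v w) (c v xor c w)) ⟩
    ∑[ w < n ] (monochromatic c v w + bichromatic c v w)
      ≡⟨ ∑-distrib-+ (monochromatic c v) (bichromatic c v) ⟩
    sameDeg c v + crossDeg c v ∎
    where open ≡-Reasoning

  monochromatic-sym : ∀ c u w → monochromatic c u w ≡ monochromatic c w u
  monochromatic-sym c u w rewrite Graph.sym G u w | xor-comm (c u) (c w) = refl

  monochromatic-loop : ∀ c v → monochromatic c v v ≡ 0
  monochromatic-loop c v rewrite irrefl G v = refl

  sameDeg-recolour : ∀ v c → sameDeg (recolour v c) v ≡ crossDeg c v
  sameDeg-recolour v c = sum-cong-≗ pointwise
    where
    pointwise : ∀ w → monochromatic (recolour v c) v w ≡ bichromatic c v w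
    pointwise w with w ≟ v
    ... | yes refl rewrite irrefl G v = refl
    ... | no w≢v rewrite updateAt-updates v {not} c | updateAt-minimal w v {not} c w≢v
                       | not-xor (c v) (c w) = refl

  monochromatic-recolour-away : ∀ v c {u w} → u ≢ v → w ≢ v →
    monochromatic (recolour v c) u w ≡ monochromatic c u w
  monochromatic-recolour-away v c {u} {w} u≢v w≢v
    rewrite updateAt-minimal u v {not} c u≢v | updateAt-minimal w v {not} c w≢v = refl

  -- Summed over all u and w this compares monoEdges before and after recolouring v
  -- without subtraction: only the row and the column of v change.
  recolour-exchange : ∀ v c u w →
    monochromatic c u w + only v u (monochromatic (recolour v c) u w) + only v w (monochromatic (recolour v c) u w)
      ≡ monochromatic (recolour v c) u w + only v u (monochromatic c u w) + only v w (monochromatic c u w)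
  recolour-exchange v c u w with u ≟ v | w ≟ v
  ... | yes refl | yes refl rewrite monochromatic-loop c v | monochromatic-loop (recolour v c) v = refl
  ... | yes refl | no _     = cong (_+ 0) (+-comm (monochromatic c v w) _)
  ... | no _     | yes refl rewrite +-identityʳ (monochromatic c u v)
                                  | +-identityʳ (monochromatic (recolour v c) u v)
    = +-comm (monochromatic c u v) _
  ... | no u≢v   | no w≢v   = cong (λ x → x + 0 + 0) (sym (monochromatic-recolour-away v c u≢v w≢v))

  monoEdges-recolour : ∀ v c →
    monoEdges c + crossDeg c v + crossDeg c v ≡ monoEdges (recolour v c) + sameDeg c v + sameDeg c v
  monoEdges-recolour v c = begin
    monoEdges c + crossDeg c v + crossDeg c v
      ≡⟨ cong₂ (λ x y → monoEdges c + x + y) (sym (sameDeg-recolour v c))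
                                              (sym (trans (column c′) (sameDeg-recolour v c))) ⟩
    monoEdges c + sameDeg c′ v + ∑[ u < n ] monochromatic c′ u v
      ≡⟨ ∑₂-only v (monochromatic c) (monochromatic c′) ⟨
    ∑[ u < n ] ∑[ w < n ] (monochromatic c u w + only v u (monochromatic c′ u w) + only v w (monochromatic c′ u w))
      ≡⟨ sum-cong-≗ (λ u → sum-cong-≗ (recolour-exchange v c u)) ⟩
    ∑[ u < n ] ∑[ w < n ] (monochromatic c′ u w + only v u (monochromatic c u w) + only v w (monochromatic c u w))
      ≡⟨ ∑₂-only v (monochromatic c′) (monochromatic c) ⟩
    monoEdges c′ + sameDeg c v + ∑[ u < n ] monochromatic c u v
      ≡⟨ cong (monoEdges c′ + sameDeg c v +_) (column c) ⟩
    monoEdges c′ + sameDeg c v + sameDeg c v ∎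
    where
    open ≡-Reasoning
    c′ = recolour v c
    column : ∀ d → ∑[ u < n ] monochromatic d u v ≡ sameDeg d v
    column d = sum-cong-≗ (λ u → monochromatic-sym d u v)

  unhappy⇒crossDeg<sameDeg : ∀ c v → ¬ deg G v ≤ 2 * crossDeg c v → crossDeg c v < sameDeg c v
  unhappy⇒crossDeg<sameDeg c v unhappy =
    +-cancelʳ-< (crossDeg c v) (crossDeg c v) (sameDeg c v) (begin-strict
    crossDeg c v + crossDeg c v  ≡⟨ cong (crossDeg c v +_) (+-identityʳ (crossDeg c v)) ⟨
    2 * crossDeg c v             <⟨ ≰⇒> unhappy ⟩
    deg G v                      ≡⟨ deg-split c v ⟩
    sameDeg c v + crossDeg c v   ∎)
    where open ≤-Reasoning

  unfriendly-from : ∀ c → Acc _<_ (monoEdges c) → Σ (Fin n → Bool) Unfriendly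
  unfriendly-from c (acc smaller) with all? (λ v → deg G v ≤? 2 * crossDeg c v)
  ... | yes allHappy = c , allHappy
  ... | no ¬unfriendly with ¬∀⟶∃¬ n _ (λ v → deg G v ≤? 2 * crossDeg c v) ¬unfriendly
  ... | v , unhappy = unfriendly-from (recolour v c) (smaller
          (m+o+o≡n+p+p∧o<p⇒n<m (monoEdges-recolour v c) (unhappy⇒crossDeg<sameDeg c v unhappy)))

  unfriendly : Σ (Fin n → Bool) Unfriendly
  unfriendly = unfriendly-from (λ _ → true) (<-wellFounded _)

  majority-isDynamo : NoIsolated G → ∀ D →
    (∀ v → lookup D v ≡ false → deg G v ≤ 2 * blackNbrs G D v) → IsDynamo G D
  majority-isDynamo noIsolated D majority = 1 , (begin
    step G D            ≡⟨ tabulate-cong turnsBlack ⟩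
    tabulate (lookup ⊤) ≡⟨ tabulate∘lookup ⊤ ⟩
    ⊤                   ∎)
    where
    open ≡-Reasoning
    ⌊⌋-true : ∀ {A : Set} (a? : Dec A) → A → ⌊ a? ⌋ ≡ true
    ⌊⌋-true a? a = trans (isYes≗does a?) (dec-true a? a)
    turnsBlack : ∀ v → (lookup D v ∨ fires G D v) ≡ lookup ⊤ v
    turnsBlack v with lookup D v in black
    ... | true  = sym (lookup-replicate v true)
    ... | false = trans (cong₂ _∧_ (⌊⌋-true (1 ≤? deg G v) (noIsolated v))
                                   (⌊⌋-true (deg G v ≤? 2 * blackNbrs G D v) (majority v black)))
                        (sym (lookup-replicate v true))

  blackNbrs-colourClass : ∀ c v → c v ≡ false → blackNbrs G (tabulate c) v ≡ crossDeg c v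
  blackNbrs-colourClass c v white =
    trans (count-tabulate (λ w → adj G v w ∧ lookup (tabulate c) w) (λ w → w))
    (sum-cong-≗ (λ w → cong (λ b → toℕ (adj G v w ∧ b))
      (trans (lookup∘tabulate c w) (cong (_xor c w) (sym white)))))

  unfriendly-isDynamo : NoIsolated G → ∀ c → Unfriendly c → IsDynamo G (tabulate c)
  unfriendly-isDynamo noIsolated c unfriendly-c = majority-isDynamo noIsolated (tabulate c) (λ v white →
    subst (λ k → deg G v ≤ 2 * k)
      (sym (blackNbrs-colourClass c v (trans (sym (lookup∘tabulate c v)) white)))
      (unfriendly-c v))

  unfriendly-not : ∀ c → Unfriendly c → Unfriendly (not ∘ c)
  unfriendly-not c unfriendly-c v = subst (λ k → deg G v ≤ 2 * k)
    (sum-cong-≗ (λ w → cong (λ b → toℕ (adj G v w ∧ b)) (sym (not-xor-not (c v) (c w)))))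
    (unfriendly-c v)

corollary1 : (n : ℕ) (G : Graph n) → NoIsolated G →
    Σ (Subset n) (λ D → IsDynamo G D × 2 * ∣ D ∣ ≤ n)
corollary1 n G noIsolated with unfriendly G
... | c , unfriendly-c with smaller-half (tabulate c)
... | inj₁ small = tabulate c , unfriendly-isDynamo G noIsolated c unfriendly-c , small
... | inj₂ small = ∁ (tabulate c) , subst (IsDynamo G) (tabulate-∘ not c)
                      (unfriendly-isDynamo G noIsolated (not ∘ c) (unfriendly-not G c unfriendly-c)) , small
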